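{- Let $n>6$ and let $\mathcal{F}\subseteq\binom{[n]}{4}$ be contained in a family of the form $\mathcal{G}_3$ with center $x$ and core $E$, and put $B=\{x\}\cup E$. If $x_1,x_2,x_3$ are distinct elements of $[n]$ with $d_{\{x_1,x_2,x_3\}}\ge n-3$, then either $\{x_1,x_2,x_3\}\subset B$, or $|\{x_1,x_2,x_3\}\cap B|=2$ and $x\in\{x_1,x_2,x_3\}$.
   Context: For a $3$-set $E\subseteq[n]$ and $x\in[n]\setminus E$, the family of the form $\mathcal{G}_3$ with center $x$ and core $E$ is $\{G\in\binom{[n]}{4}:E\subseteq G\}\cup\{G\in\binom{[n]}{4}:x\in G,\ G\cap E\ne\emptyset\}$. For $S\subseteq[n]$, $d_S$ denotes the number of members of $\mathcal{F}$ containing $S$. -}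

module Defs where

open import Data.Nat using (ℕ)
open import Data.Fin using (Fin)
open import Data.Fin.Subset using (Subset; _∈_; _∉_; _⊆_; _∩_; _∪_; ⁅_⁆; ∣_∣; Nonempty)
open import Data.Fin.Subset.Properties using (_⊆?_)
open import Data.List using (List; filter; length)
open import Data.Product using (_×_)
open import Data.Sum using (_⊎_)
open import Relation.Binary.PropositionalEquality using (_≡_)

InG3 : ∀ {n} → Fin n → Subset n → Subset n → Set
InG3 x E G = (∣ G ∣ ≡ 4) × (E ⊆ G ⊎ (x ∈ G × Nonempty (G ∩ E)))

-- d_S : number of members of the family F (a duplicate-free list) containing S.
deg : ∀ {n} → List (Subset n) → Subset n → ℕ
deg F S = length (filter (S ⊆?_) F)

triple : ∀ {n} → Fin n → Fin n → Fin n → Subset n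
triple a b c = ⁅ a ⁆ ∪ (⁅ b ⁆ ∪ ⁅ c ⁆)

{-# OPTIONS --safe #-}
module Submission where

-- If d_T ≥ n − 3 for a 3-set T, then each of the n − 3 four-sets T ∪ {y} lies in F:
-- distinct members of F containing T differ in their point outside T, so if one
-- extension were missing there would be at most n − 4 of them. Hence every T ∪ {y}
-- lies in G₃. A point y outside T ∪ E (|T ∪ E| ≤ 6 < n) shows that T meets
-- B = {x} ∪ E; then |T ∪ B| ≤ 6, and a point y outside T ∪ B gives either E ⊆ T,
-- so T = E ⊆ B, or x ∈ T together with a point of E in T, so |T ∩ B| ≥ 2.

open import Defs
open import Data.Bool using (true; false) renaming (_≟_ to _≟ᵇ_)
open import Data.Empty using (⊥-elim)
open import Data.Fin using (Fin; zero) renaming (suc to fsuc)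
open import Data.Fin.Subset
  using (Subset; _∈_; _∉_; _⊆_; _∩_; _∪_; _-_; ∁; ⁅_⁆; ∣_∣; Nonempty; Empty)
open import Data.Fin.Subset.Properties
  using (_∈?_; _⊆?_; nonempty?; Empty-unique; ∣⊥∣≡0; ∣p∣≤n; ∣⁅x⁆∣≡1; ∣∁p∣≡n∸∣p∣;
         p⊆q⇒∣p∣≤∣q∣; p⊂q⇒∣p∣<∣q∣; x∈p⇒∣p-x∣<∣p∣; ⊆-antisym;
         x∈⁅x⁆; x∈⁅y⁆⇒x≡y; x≢y⇒x∉⁅y⁆; x∈p∪q⁺; x∈p∪q⁻; x∈p∩q⁺; x∈p∩q⁻;
         x∈p∧x≢y⇒x∈p-y; x∉p⇒x∈∁p; p∩q⊆p)
open import Data.Fin.Properties using (any?)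
open import Data.List.Relation.Unary.Any using () renaming (any? to anyₗ?)
open import Data.List using (List; []; _∷_; length; filter)
open import Data.Vec.Properties using (≡-dec)
open import Data.List.Membership.Propositional using () renaming (_∈_ to _∈ₗ_)
open import Data.List.Membership.Propositional.Properties using (∈-filter⁻)
open import Data.List.Relation.Unary.All as All using (All; []; _∷_)
open import Data.List.Relation.Unary.AllPairs using (_∷_)
open import Data.List.Relation.Unary.Unique.Propositional using (Unique)
import Data.List.Relation.Unary.Unique.Propositional.Properties as Unique
open import Data.Nat using (ℕ; suc; _+_; _∸_; _≤_; _<_; z≤n; s≤s)
open import Data.Nat.Properties
open import Data.Product as Product using (_×_; _,_; ∃; proj₁; proj₂)
open import Data.Sum as Sum using (_⊎_; inj₁; inj₂)
open import Data.Vec using (_∷_; []; there)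
open import Function using (_∘_)
open import Relation.Nullary using (¬_; yes; no; ¬?; contradiction)
open import Relation.Nullary.Decidable using (_×-dec_)
open import Relation.Binary.PropositionalEquality
  using (_≡_; _≢_; refl; sym; trans; cong; cong₂; subst; module ≡-Reasoning)

⊈⇒∃∈∉ : ∀ {n} {p q : Subset n} → ¬ p ⊆ q → ∃ λ x → x ∈ p × x ∉ q
⊈⇒∃∈∉ {p = p} {q} p⊈q with any? (λ x → (x ∈? p) ×-dec ¬? (x ∈? q))
... | yes witness = witness
... | no none = ⊥-elim (p⊈q p⊆q)
  where
  p⊆q : p ⊆ q
  p⊆q {x} x∈p with x ∈? q
  ... | yes x∈q = x∈q
  ... | no x∉q = ⊥-elim (none (x , x∈p , x∉q))

p⊆q∧∣q∣≤∣p∣⇒q⊆p : ∀ {n} {p q : Subset n} → p ⊆ q → ∣ q ∣ ≤ ∣ p ∣ → q ⊆ p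
p⊆q∧∣q∣≤∣p∣⇒q⊆p {p = p} {q} p⊆q ∣q∣≤∣p∣ with q ⊆? p
... | yes q⊆p = q⊆p
... | no q⊈p = contradiction ∣q∣≤∣p∣ (<⇒≱ (p⊂q⇒∣p∣<∣q∣ (p⊆q , ⊈⇒∃∈∉ q⊈p)))

∣p∣<n⇒∃∉ : ∀ {n} (p : Subset n) → ∣ p ∣ < n → ∃ λ x → x ∉ p
∣p∣<n⇒∃∉ (false ∷ p) _ = zero , λ ()
∣p∣<n⇒∃∉ (true ∷ p) (s≤s ∣p∣<n) =
  let x , x∉p = ∣p∣<n⇒∃∉ p ∣p∣<n in fsuc x , λ { (there x∈p) → x∉p x∈p }

Empty⇒∣p∣≡0 : ∀ {n} {p : Subset n} → Empty p → ∣ p ∣ ≡ 0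
Empty⇒∣p∣≡0 {n} empty = trans (cong ∣_∣ (Empty-unique empty)) (∣⊥∣≡0 n)

0<∣p∣⇒Nonempty : ∀ {n} {p : Subset n} → 0 < ∣ p ∣ → Nonempty p
0<∣p∣⇒Nonempty {p = p} 0<∣p∣ with nonempty? p
... | yes ne = ne
... | no empty = contradiction (subst (0 <_) (Empty⇒∣p∣≡0 empty) 0<∣p∣) (λ ())

x∉p∪q⇒x∉p : ∀ {n} {x : Fin n} {p q : Subset n} → x ∉ p ∪ q → x ∉ p
x∉p∪q⇒x∉p x∉p∪q x∈p = x∉p∪q (x∈p∪q⁺ (inj₁ x∈p))

x∉p∪q⇒x∉q : ∀ {n} {x : Fin n} {p q : Subset n} → x ∉ p ∪ q → x ∉ q
x∉p∪q⇒x∉q x∉p∪q x∈q = x∉p∪q (x∈p∪q⁺ (inj₂ x∈q))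

x∈p∪q∧x∉p⇒x∈q : ∀ {n} {x : Fin n} {p q : Subset n} → x ∈ p ∪ q → x ∉ p → x ∈ q
x∈p∪q∧x∉p⇒x∈q {p = p} {q} x∈p∪q x∉p with x∈p∪q⁻ p q x∈p∪q
... | inj₁ x∈p = contradiction x∈p x∉p
... | inj₂ x∈q = x∈q

x∈p∪q∧x∉q⇒x∈p : ∀ {n} {x : Fin n} {p q : Subset n} → x ∈ p ∪ q → x ∉ q → x ∈ p
x∈p∪q∧x∉q⇒x∈p {p = p} {q} x∈p∪q x∉q with x∈p∪q⁻ p q x∈p∪q
... | inj₁ x∈p = x∈p
... | inj₂ x∈q = contradiction x∈q x∉q

x∈p∧y∉p⇒x∉⁅y⁆ : ∀ {n} {x y : Fin n} {p : Subset n} → x ∈ p → y ∉ p → x ∉ ⁅ y ⁆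
x∈p∧y∉p⇒x∉⁅y⁆ x∈p y∉p = x≢y⇒x∉⁅y⁆ λ { refl → y∉p x∈p }

⊆∪-intro : ∀ {n} {p q r : Subset n} → (∀ {x} → x ∈ p → x ∉ q → x ∈ r) → p ⊆ q ∪ r
⊆∪-intro {q = q} outside {x} x∈p with x ∈? q
... | yes x∈q = x∈p∪q⁺ (inj₁ x∈q)
... | no x∉q = x∈p∪q⁺ (inj₂ (outside x∈p x∉q))

⁅x⁆∪p⊆q : ∀ {n} {x : Fin n} {p q : Subset n} → x ∈ q → p ⊆ q → ⁅ x ⁆ ∪ p ⊆ q
⁅x⁆∪p⊆q {x = x} {p} {q} x∈q p⊆q y∈ with x∈p∪q⁻ ⁅ x ⁆ p y∈
... | inj₁ y∈⁅x⁆ = subst (_∈ q) (sym (x∈⁅y⁆⇒x≡y x y∈⁅x⁆)) x∈q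
... | inj₂ y∈p = p⊆q y∈p

∣p∪q∣+∣p∩q∣≡∣p∣+∣q∣ : ∀ {n} (p q : Subset n) → ∣ p ∪ q ∣ + ∣ p ∩ q ∣ ≡ ∣ p ∣ + ∣ q ∣
∣p∪q∣+∣p∩q∣≡∣p∣+∣q∣ [] [] = refl
∣p∪q∣+∣p∩q∣≡∣p∣+∣q∣ (true ∷ p) (true ∷ q) = cong suc (begin
  ∣ p ∪ q ∣ + suc ∣ p ∩ q ∣  ≡⟨ +-suc _ _ ⟩
  suc (∣ p ∪ q ∣ + ∣ p ∩ q ∣) ≡⟨ cong suc (∣p∪q∣+∣p∩q∣≡∣p∣+∣q∣ p q) ⟩
  suc (∣ p ∣ + ∣ q ∣)         ≡⟨ +-suc _ _ ⟨
  ∣ p ∣ + suc ∣ q ∣           ∎)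
  where open ≡-Reasoning
∣p∪q∣+∣p∩q∣≡∣p∣+∣q∣ (true ∷ p) (false ∷ q) = cong suc (∣p∪q∣+∣p∩q∣≡∣p∣+∣q∣ p q)
∣p∪q∣+∣p∩q∣≡∣p∣+∣q∣ (false ∷ p) (true ∷ q) =
  trans (cong suc (∣p∪q∣+∣p∩q∣≡∣p∣+∣q∣ p q)) (sym (+-suc _ _))
∣p∪q∣+∣p∩q∣≡∣p∣+∣q∣ (false ∷ p) (false ∷ q) = ∣p∪q∣+∣p∩q∣≡∣p∣+∣q∣ p q

∣⁅x⁆∪p∣≡1+∣p∣ : ∀ {n} {x : Fin n} {p : Subset n} → x ∉ p → ∣ ⁅ x ⁆ ∪ p ∣ ≡ 1 + ∣ p ∣
∣⁅x⁆∪p∣≡1+∣p∣ {x = x} {p} x∉p = begin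
  ∣ ⁅ x ⁆ ∪ p ∣                     ≡⟨ +-identityʳ _ ⟨
  ∣ ⁅ x ⁆ ∪ p ∣ + 0                 ≡⟨ cong (∣ ⁅ x ⁆ ∪ p ∣ +_) (Empty⇒∣p∣≡0 disjoint) ⟨
  ∣ ⁅ x ⁆ ∪ p ∣ + ∣ ⁅ x ⁆ ∩ p ∣     ≡⟨ ∣p∪q∣+∣p∩q∣≡∣p∣+∣q∣ ⁅ x ⁆ p ⟩
  ∣ ⁅ x ⁆ ∣ + ∣ p ∣                 ≡⟨ cong (_+ ∣ p ∣) (∣⁅x⁆∣≡1 x) ⟩
  1 + ∣ p ∣                         ∎
  where
  open ≡-Reasoning
  disjoint : Empty (⁅ x ⁆ ∩ p)
  disjoint (y , y∈⁅x⁆∩p) =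
    let y∈⁅x⁆ , y∈p = x∈p∩q⁻ ⁅ x ⁆ p y∈⁅x⁆∩p
    in x∉p (subst (_∈ p) (x∈⁅y⁆⇒x≡y x y∈⁅x⁆) y∈p)

∣p∩q∣<∣p∣ : ∀ {n} {p q : Subset n} → ¬ p ⊆ q → ∣ p ∩ q ∣ < ∣ p ∣
∣p∩q∣<∣p∣ {p = p} {q} p⊈q with ⊈⇒∃∈∉ p⊈q
... | x , x∈p , x∉q =
  p⊂q⇒∣p∣<∣q∣ (p∩q⊆p p q , x , x∈p , λ x∈p∩q → x∉q (proj₂ (x∈p∩q⁻ p q x∈p∩q)))

x∈p∧y∈p∧x≢y⇒2≤∣p∣ : ∀ {n} {x y : Fin n} {p : Subset n} → x ∈ p → y ∈ p → x ≢ y → 2 ≤ ∣ p ∣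
x∈p∧y∈p∧x≢y⇒2≤∣p∣ {x = x} {y} {p} x∈p y∈p x≢y = begin
  2                 ≡⟨ cong suc (∣⁅x⁆∣≡1 y) ⟨
  1 + ∣ ⁅ y ⁆ ∣     ≡⟨ ∣⁅x⁆∪p∣≡1+∣p∣ (x≢y⇒x∉⁅y⁆ x≢y) ⟨
  ∣ ⁅ x ⁆ ∪ ⁅ y ⁆ ∣ ≤⟨ p⊆q⇒∣p∣≤∣q∣ (⁅x⁆∪p⊆q x∈p ⁅y⁆⊆p) ⟩
  ∣ p ∣             ∎
  where
  open ≤-Reasoning
  ⁅y⁆⊆p : ⁅ y ⁆ ⊆ p
  ⁅y⁆⊆p z∈⁅y⁆ = subst (_∈ p) (sym (x∈⁅y⁆⇒x≡y y z∈⁅y⁆)) y∈p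

OnePointExtension : ∀ {n} → Subset n → Subset n → Set
OnePointExtension T G = ∣ G ∣ ≡ suc ∣ T ∣ × T ⊆ G

module _ {n} {T G : Subset n} (ext : OnePointExtension T G) where

  extension-⊈ : ¬ G ⊆ T
  extension-⊈ G⊆T = <⇒≱ (≤-reflexive (sym (proj₁ ext))) (p⊆q⇒∣p∣≤∣q∣ G⊆T)

  extension≡⁅x⁆∪ : ∀ {x} → x ∈ G → x ∉ T → G ≡ ⁅ x ⁆ ∪ T
  extension≡⁅x⁆∪ {x} x∈G x∉T = ⊆-antisym (p⊆q∧∣q∣≤∣p∣⇒q⊆p T+x⊆G ∣G∣≤∣T+x∣) T+x⊆G
    where
    T+x⊆G : ⁅ x ⁆ ∪ T ⊆ G
    T+x⊆G = ⁅x⁆∪p⊆q x∈G (proj₂ ext)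
    ∣G∣≤∣T+x∣ : ∣ G ∣ ≤ ∣ ⁅ x ⁆ ∪ T ∣
    ∣G∣≤∣T+x∣ = ≤-reflexive (trans (proj₁ ext) (sym (∣⁅x⁆∪p∣≡1+∣p∣ x∉T)))

extensions-count : ∀ {n} {T S : Subset n} (L : List (Subset n)) → Unique L →
  All (OnePointExtension T) L → All (_⊆ T ∪ S) L → length L ≤ ∣ S ∣
extensions-count [] _ _ _ = z≤n
extensions-count {T = T} {S} (G ∷ L) (G∉L ∷ uniq) (extG ∷ exts) (G⊆ ∷ ⊆s)
  with ⊈⇒∃∈∉ (extension-⊈ extG)
... | x , x∈G , x∉T =
  <-≤-trans (s≤s (extensions-count L uniq exts shrunk)) (x∈p⇒∣p-x∣<∣p∣ x∈S)
  where
  x∈S : x ∈ S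
  x∈S = x∈p∪q∧x∉p⇒x∈q (G⊆ x∈G) x∉T
  shrunk : All (_⊆ T ∪ (S - x)) L
  shrunk = All.tabulate λ {H} H∈L → ⊆∪-intro λ {y} y∈H y∉T →
    x∈p∧x≢y⇒x∈p-y (x∈p∪q∧x∉p⇒x∈q (All.lookup ⊆s H∈L y∈H) y∉T) λ { refl →
      All.lookup G∉L H∈L (trans (extension≡⁅x⁆∪ extG x∈G x∉T)
                                (sym (extension≡⁅x⁆∪ (All.lookup exts H∈L) y∈H y∉T))) }

extensions-saturated : ∀ {n} {T : Subset n} (F : List (Subset n)) → Unique F →
  All (λ G → ∣ G ∣ ≡ suc ∣ T ∣) F → n ∸ ∣ T ∣ ≤ deg F T →
  ∀ {x} → x ∉ T → ⁅ x ⁆ ∪ T ∈ₗ F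
extensions-saturated {n} {T} F uniq sizes saturated {x} x∉T
  with anyₗ? (≡-dec _≟ᵇ_ (⁅ x ⁆ ∪ T)) F
... | yes T+x∈F = T+x∈F
... | no T+x∉F = contradiction (≤-trans saturated counted) (<⇒≱ fewer)
  where
  L : List (Subset n)
  L = filter (T ⊆?_) F
  S : Subset n
  S = ∁ (⁅ x ⁆ ∪ T)
  exts : All (OnePointExtension T) L
  exts = All.tabulate λ G∈L →
    let G∈F , T⊆G = ∈-filter⁻ (T ⊆?_) G∈L in All.lookup sizes G∈F , T⊆G
  x∉L : ∀ {G} → G ∈ₗ L → x ∉ G
  x∉L G∈L x∈G = T+x∉F (subst (_∈ₗ F)
    (extension≡⁅x⁆∪ (All.lookup exts G∈L) x∈G x∉T) (proj₁ (∈-filter⁻ (T ⊆?_) G∈L)))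
  avoid : All (_⊆ T ∪ S) L
  avoid = All.tabulate λ {G} G∈L → ⊆∪-intro λ {y} y∈G y∉T → x∉p⇒x∈∁p λ y∈T+x →
    x∉L G∈L (subst (_∈ G) (x∈⁅y⁆⇒x≡y x (x∈p∪q∧x∉q⇒x∈p y∈T+x y∉T)) y∈G)
  ∣S∣≡ : ∣ S ∣ ≡ n ∸ suc ∣ T ∣
  ∣S∣≡ = trans (∣∁p∣≡n∸∣p∣ (⁅ x ⁆ ∪ T)) (cong (n ∸_) (∣⁅x⁆∪p∣≡1+∣p∣ x∉T))
  counted : length L ≤ n ∸ suc ∣ T ∣
  counted = subst (length L ≤_) ∣S∣≡
    (extensions-count L (Unique.filter⁺ (T ⊆?_) uniq) exts avoid)
  fewer : n ∸ suc ∣ T ∣ < n ∸ ∣ T ∣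
  fewer = ∸-monoʳ-< (n<1+n _) (subst (_≤ n) (∣⁅x⁆∪p∣≡1+∣p∣ x∉T) (∣p∣≤n (⁅ x ⁆ ∪ T)))

x∈⁅y⁆∪⁅z⁆⇒ : ∀ {n} {x y z : Fin n} → x ∈ ⁅ y ⁆ ∪ ⁅ z ⁆ → x ≡ y ⊎ x ≡ z
x∈⁅y⁆∪⁅z⁆⇒ {y = y} {z} x∈ with x∈p∪q⁻ ⁅ y ⁆ ⁅ z ⁆ x∈
... | inj₁ x∈⁅y⁆ = inj₁ (x∈⁅y⁆⇒x≡y y x∈⁅y⁆)
... | inj₂ x∈⁅z⁆ = inj₂ (x∈⁅y⁆⇒x≡y z x∈⁅z⁆)

x∈triple⇒ : ∀ {n} {x a b c : Fin n} → x ∈ triple a b c → x ≡ a ⊎ (x ≡ b ⊎ x ≡ c)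
x∈triple⇒ {a = a} {b} {c} x∈ with x∈p∪q⁻ ⁅ a ⁆ (⁅ b ⁆ ∪ ⁅ c ⁆) x∈
... | inj₁ x∈⁅a⁆ = inj₁ (x∈⁅y⁆⇒x≡y a x∈⁅a⁆)
... | inj₂ x∈⁅b⁆∪⁅c⁆ = inj₂ (x∈⁅y⁆∪⁅z⁆⇒ x∈⁅b⁆∪⁅c⁆)

∣triple∣≡3 : ∀ {n} {a b c : Fin n} → a ≢ b → a ≢ c → b ≢ c → ∣ triple a b c ∣ ≡ 3
∣triple∣≡3 {a = a} {b} {c} a≢b a≢c b≢c = begin
  ∣ ⁅ a ⁆ ∪ (⁅ b ⁆ ∪ ⁅ c ⁆) ∣ ≡⟨ ∣⁅x⁆∪p∣≡1+∣p∣ a∉⁅b⁆∪⁅c⁆ ⟩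
  1 + ∣ ⁅ b ⁆ ∪ ⁅ c ⁆ ∣       ≡⟨ cong suc (∣⁅x⁆∪p∣≡1+∣p∣ (x≢y⇒x∉⁅y⁆ b≢c)) ⟩
  2 + ∣ ⁅ c ⁆ ∣               ≡⟨ cong (2 +_) (∣⁅x⁆∣≡1 c) ⟩
  3                           ∎
  where
  open ≡-Reasoning
  a∉⁅b⁆∪⁅c⁆ : a ∉ ⁅ b ⁆ ∪ ⁅ c ⁆
  a∉⁅b⁆∪⁅c⁆ a∈ with x∈⁅y⁆∪⁅z⁆⇒ a∈
  ... | inj₁ a≡b = a≢b a≡b
  ... | inj₂ a≡c = a≢c a≡c

InG3-⁅y⁆∪ : ∀ {n} {x y : Fin n} {E T : Subset n} → y ∉ E → InG3 x E (⁅ y ⁆ ∪ T) →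
  E ⊆ T ⊎ (x ∈ ⁅ y ⁆ ∪ T × Nonempty (T ∩ E))
InG3-⁅y⁆∪ y∉E (_ , inj₁ E⊆T+y) =
  inj₁ λ e∈E → x∈p∪q∧x∉p⇒x∈q (E⊆T+y e∈E) (x∈p∧y∉p⇒x∉⁅y⁆ e∈E y∉E)
InG3-⁅y⁆∪ {y = y} {E} {T} y∉E (_ , inj₂ (x∈T+y , e , e∈T+y∩E)) =
  let e∈T+y , e∈E = x∈p∩q⁻ (⁅ y ⁆ ∪ T) E e∈T+y∩E
  in inj₂ (x∈T+y , e , x∈p∩q⁺ (x∈p∪q∧x∉p⇒x∈q e∈T+y (x∈p∧y∉p⇒x∉⁅y⁆ e∈E y∉E) , e∈E))

module _ {n} (6<n : 6 < n) {x : Fin n} {E T : Subset n}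
         (∣E∣≡3 : ∣ E ∣ ≡ 3) (x∉E : x ∉ E) (∣T∣≡3 : ∣ T ∣ ≡ 3)
         (extensions : ∀ {y} → y ∉ T → InG3 x E (⁅ y ⁆ ∪ T)) where

  private
    B : Subset n
    B = ⁅ x ⁆ ∪ E

    x∈B : x ∈ B
    x∈B = x∈p∪q⁺ (inj₁ (x∈⁅x⁆ x))

    E⊆B : E ⊆ B
    E⊆B e∈E = x∈p∪q⁺ (inj₂ e∈E)

    ∣B∣≡4 : ∣ B ∣ ≡ 4
    ∣B∣≡4 = trans (∣⁅x⁆∪p∣≡1+∣p∣ x∉E) (cong suc ∣E∣≡3)

    ∣T∪E∣<n : ∣ T ∪ E ∣ < n
    ∣T∪E∣<n = begin-strict
      ∣ T ∪ E ∣               ≤⟨ m≤m+n _ _ ⟩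
      ∣ T ∪ E ∣ + ∣ T ∩ E ∣   ≡⟨ ∣p∪q∣+∣p∩q∣≡∣p∣+∣q∣ T E ⟩
      ∣ T ∣ + ∣ E ∣           ≡⟨ cong₂ _+_ ∣T∣≡3 ∣E∣≡3 ⟩
      6                       <⟨ 6<n ⟩
      n                       ∎
      where open ≤-Reasoning

    ∣T∪B∣<n : Nonempty (T ∩ B) → ∣ T ∪ B ∣ < n
    ∣T∪B∣<n (w , w∈T∩B) = begin-strict
      ∣ T ∪ B ∣               ≡⟨ +-identityʳ _ ⟨
      ∣ T ∪ B ∣ + 0           <⟨ +-monoʳ-< ∣ T ∪ B ∣ (≤-<-trans z≤n (x∈p⇒∣p-x∣<∣p∣ w∈T∩B)) ⟩
      ∣ T ∪ B ∣ + ∣ T ∩ B ∣   ≡⟨ ∣p∪q∣+∣p∩q∣≡∣p∣+∣q∣ T B ⟩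
      ∣ T ∣ + ∣ B ∣           ≡⟨ cong₂ _+_ ∣T∣≡3 ∣B∣≡4 ⟩
      7                       ≤⟨ 6<n ⟩
      n                       ∎
      where open ≤-Reasoning

  T∩B-nonempty : Nonempty (T ∩ B)
  T∩B-nonempty with ∣p∣<n⇒∃∉ (T ∪ E) ∣T∪E∣<n
  ... | y , y∉T∪E with InG3-⁅y⁆∪ (x∉p∪q⇒x∉q y∉T∪E) (extensions (x∉p∪q⇒x∉p y∉T∪E))
  ...   | inj₁ E⊆T =
    let e , e∈E = 0<∣p∣⇒Nonempty (subst (0 <_) (sym ∣E∣≡3) (s≤s z≤n))
    in e , x∈p∩q⁺ (E⊆T e∈E , E⊆B e∈E)
  ...   | inj₂ (_ , e , e∈T∩E) =
    let e∈T , e∈E = x∈p∩q⁻ T E e∈T∩E in e , x∈p∩q⁺ (e∈T , E⊆B e∈E)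

  G3-saturated-triple : T ⊆ B ⊎ (∣ T ∩ B ∣ ≡ 2 × x ∈ T)
  G3-saturated-triple with ∣p∣<n⇒∃∉ (T ∪ B) (∣T∪B∣<n T∩B-nonempty)
  ... | y , y∉T∪B with InG3-⁅y⁆∪ (x∉p∪q⇒x∉q (x∉p∪q⇒x∉q y∉T∪B)) (extensions (x∉p∪q⇒x∉p y∉T∪B))
  ...   | inj₁ E⊆T = inj₁ λ t∈T → E⊆B (p⊆q∧∣q∣≤∣p∣⇒q⊆p E⊆T ∣T∣≤∣E∣ t∈T)
    where
    ∣T∣≤∣E∣ : ∣ T ∣ ≤ ∣ E ∣
    ∣T∣≤∣E∣ = ≤-reflexive (trans ∣T∣≡3 (sym ∣E∣≡3))
  ...   | inj₂ (x∈T+y , e , e∈T∩E) with T ⊆? B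
  ...     | yes T⊆B = inj₁ T⊆B
  ...     | no T⊈B = inj₂ (≤-antisym ∣T∩B∣≤2 2≤∣T∩B∣ , x∈T)
    where
    x∈T : x ∈ T
    x∈T = x∈p∪q∧x∉p⇒x∈q x∈T+y (x∈p∧y∉p⇒x∉⁅y⁆ x∈B (x∉p∪q⇒x∉q y∉T∪B))
    ∣T∩B∣≤2 : ∣ T ∩ B ∣ ≤ 2
    ∣T∩B∣≤2 = ≤-pred (≤-trans (∣p∩q∣<∣p∣ T⊈B) (≤-reflexive ∣T∣≡3))
    2≤∣T∩B∣ : 2 ≤ ∣ T ∩ B ∣
    2≤∣T∩B∣ = let e∈T , e∈E = x∈p∩q⁻ T E e∈T∩E in
      x∈p∧y∈p∧x≢y⇒2≤∣p∣ (x∈p∩q⁺ (x∈T , x∈B)) (x∈p∩q⁺ (e∈T , E⊆B e∈E))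
                        λ { refl → x∉E e∈E }

claim3p3 : (n : ℕ) → 6 < n →
    (x : Fin n) (E : Subset n) → ∣ E ∣ ≡ 3 → x ∉ E →
    (F : List (Subset n)) → Unique F → All (InG3 x E) F →
    (x₁ x₂ x₃ : Fin n) → x₁ ≢ x₂ → x₁ ≢ x₃ → x₂ ≢ x₃ →
    n ∸ 3 ≤ deg F (triple x₁ x₂ x₃) →
    triple x₁ x₂ x₃ ⊆ (⁅ x ⁆ ∪ E)
    ⊎ ((∣ triple x₁ x₂ x₃ ∩ (⁅ x ⁆ ∪ E) ∣ ≡ 2) × (x ≡ x₁ ⊎ (x ≡ x₂ ⊎ x ≡ x₃)))
claim3p3 n 6<n x E ∣E∣≡3 x∉E F uniq F⊆G3 x₁ x₂ x₃ x₁≢x₂ x₁≢x₃ x₂≢x₃ saturated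
  = Sum.map₂ (Product.map₂ x∈triple⇒) (G3-saturated-triple 6<n ∣E∣≡3 x∉E ∣T∣≡3 extensions)
  where
  T : Subset n
  T = triple x₁ x₂ x₃
  ∣T∣≡3 : ∣ T ∣ ≡ 3
  ∣T∣≡3 = ∣triple∣≡3 x₁≢x₂ x₁≢x₃ x₂≢x₃
  extensions : ∀ {y} → y ∉ T → InG3 x E (⁅ y ⁆ ∪ T)
  extensions = All.lookup F⊆G3 ∘ extensions-saturated F uniq
    (All.map (λ G∈G3 → trans (proj₁ G∈G3) (cong suc (sym ∣T∣≡3))) F⊆G3)
    (subst (λ k → n ∸ k ≤ deg F T) (sym ∣T∣≡3) saturated)
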